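{- Let $\vdash$ be a substitution-invariant multiset deductive relation on a propositional language $\mathcal{L}$. (1) For every $\mathcal{L}$-algebra $\mathbf{A}$, the family $(\mathcal{F}i_\vdash(\mathbf{A}))^p$ is a deductive system on $\langle A^\flat,\leqslant,\uplus,\emptyset\rangle$, and $\mathcal{F}i_\vdash(\mathbf{A})=\{\bigcup\mathcal{Y}:\mathcal{Y}\subseteq(\mathcal{F}i_\vdash(\mathbf{A}))^p\}$. (2) $(\mathcal{F}i_\vdash(\mathbf{Fm}_{\mathcal{L}}))^p=\{\{\Delta\in Fm_{\mathcal{L}}^\flat:\Gamma\vdash\Delta\}:\Gamma\in Fm_{\mathcal{L}}^\flat\}$.
   Context: For a set $X$, $X^\flat$ is the set of finite multisets over $X$, with sub-multiset order $\leqslant$, sum $\uplus$, empty multiset $\emptyset$; homomorphisms extend elementwise. A multiset deductive relation (MDR) on $\mathcal{L}$ is a relation $\vdash$ on $Fm_{\mathcal{L}}^\flat$ with $\Gamma\uplus\Delta\vdash\Gamma$; $\Gamma\vdash\Delta\Rightarrow\Gamma\uplus\Pi\vdash\Delta\uplus\Pi$; transitivity; substitution-invariant if $\Gamma\vdash\Delta\Rightarrow\sigma(\Gamma)\vdash\sigma(\Delta)$ for all substitutions. A set $F\subseteq A^\flat$ is a $\vdash$-filter on $\mathbf{A}$ if $F$ is a $\leqslant$-downset and for all $\Gamma\vdash\Delta$, all $\mathfrak{C}\in A^\flat$ and homomorphisms $f\colon\mathbf{Fm}_{\mathcal{L}}\to\mathbf{A}$, $\mathfrak{C}\uplus f(\Gamma)\in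 F$ implies $\mathfrak{C}\uplus f(\Delta)\in F$; $\mathcal{F}i_\vdash(\mathbf{A})$ is the set of $\vdash$-filters on $\mathbf{A}$ (a closure system on $A^\flat$). For a closure system $\mathcal{C}$ on $X$, $\mathcal{C}^p=\{\bigcap\{C\in\mathcal{C}:x\in C\}:x\in X\}$. A deductive system on a dually integral Abelian pomonoid $\langle R,\leq,+,0\rangle$ (commutative monoid, compatible partial order, $0$ least) is a family $\mathcal{C}$ of $\leq$-downsets of $R$ such that, with $\delta_{\mathcal{C}}(x)=\bigcap\{C\in\mathcal{C}:x\in C\}$, $\{\delta_{\mathcal{C}}(x):x\in R\}=\mathcal{C}$ and $\delta_{\mathcal{C}}(x)\subseteq\delta_{\mathcal{C}}(y)$ implies $\delta_{\mathcal{C}}(x+z)\subseteq\delta_{\mathcal{C}}(y+z)$. -}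

module Defs where

open import Level using (Level; _⊔_; 0ℓ) renaming (suc to lsuc)
open import Data.Nat using (ℕ)
open import Data.Fin using (Fin)
open import Data.List using (List; []; _++_; map)
open import Data.List.Relation.Binary.Permutation.Propositional using (_↭_)
open import Data.Product using (Σ; ∃; _×_; _,_)
open import Relation.Unary using (Pred; _⊆_; _≐_)
open import Relation.Binary.PropositionalEquality using (_≡_)
open import Function using (_∘_)

-- Finite multisets over X are represented by lists over X, considered
-- up to permutation (_↭_).  Sum is _++_, the empty multiset is [].

_≤ₘ_ : ∀ {a} {X : Set a} → List X → List X → Set a
Γ ≤ₘ Δ = ∃ λ Π → (Γ ++ Π) ↭ Δ

Img : ∀ {r ℓ} {R : Set r} {X : Set r} → (R → Pred X ℓ) → Pred (Pred X ℓ) (r ⊔ ℓ)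
Img {R = R} g S = ∃ λ (x : R) → S ≐ g x

_≋_ : ∀ {x ℓ₁ ℓ₂ k₁ k₂} {X : Set x} → Pred (Pred X ℓ₁) k₁ → Pred (Pred X ℓ₂) k₂ → Set _
𝒞 ≋ 𝒟 = (∀ C → 𝒞 C → ∃ λ D → 𝒟 D × C ≐ D) × (∀ D → 𝒟 D → ∃ λ C → 𝒞 C × C ≐ D)

δ : ∀ {x ℓ k} {X : Set x} → Pred (Pred X ℓ) k → X → Pred X (x ⊔ lsuc ℓ ⊔ k)
δ {ℓ = ℓ} {X = X} 𝒞 x y = (C : Pred X ℓ) → 𝒞 C → C x → C y

_ᵖ : ∀ {x ℓ k} {X : Set x} → Pred (Pred X ℓ) k → Pred (Pred X (x ⊔ lsuc ℓ ⊔ k)) _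
𝒞 ᵖ = Img (δ 𝒞)

⋃ : ∀ {x ℓ k} {X : Set x} → Pred (Pred X ℓ) k → Pred X (x ⊔ lsuc ℓ ⊔ k)
⋃ {ℓ = ℓ} {X = X} 𝒴 y = Σ (Pred X ℓ) λ S → 𝒴 S × S y

IsDownset : ∀ {r ℓ ℓ'} {R : Set r} → (R → R → Set ℓ') → Pred R ℓ → Set _
IsDownset _≤_ C = ∀ {x y} → x ≤ y → C y → C x

record IsDeductiveSystem {r ℓ' ℓ k} {R : Set r}
         (_≤_ : R → R → Set ℓ') (_+_ : R → R → R) (e : R)
         (𝒞 : Pred (Pred R ℓ) k) : Set (lsuc r ⊔ ℓ' ⊔ lsuc (lsuc ℓ) ⊔ lsuc k) where
  field
    downsets  : ∀ C → 𝒞 C → IsDownset _≤_ C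
    principal : Img (δ 𝒞) ≋ 𝒞
    compat    : ∀ x y z → δ 𝒞 x ⊆ δ 𝒞 y → δ 𝒞 (x + z) ⊆ δ 𝒞 (y + z)

record Language : Set₁ where
  field
    Op    : Set
    arity : Op → ℕ
open Language public

data Fm (L : Language) : Set where
  var : ℕ → Fm L
  app : (o : Op L) → (Fin (arity L o) → Fm L) → Fm L

record Algebra (L : Language) (a : Level) : Set (lsuc a) where
  field
    Carrier : Set a
    ⟦_⟧     : (o : Op L) → (Fin (arity L o) → Carrier) → Carrier
open Algebra public

FmAlg : (L : Language) → Algebra L 0ℓ
FmAlg L = record { Carrier = Fm L ; ⟦_⟧ = app }

IsHom : ∀ {L a} (A : Algebra L a) → (Fm L → Carrier A) → Set a
IsHom {L} A f = ∀ (o : Op L) (ts : Fin (arity L o) → Fm L) → f (app o ts) ≡ ⟦ A ⟧ o (f ∘ ts)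

record IsMDR {L : Language} (_⊢_ : List (Fm L) → List (Fm L) → Set) : Set where
  field
    -- _⊢_ is a relation on multisets (invariant under permutation)
    wellDefined : ∀ {Γ Γ' Δ Δ'} → Γ ↭ Γ' → Δ ↭ Δ' → Γ ⊢ Δ → Γ' ⊢ Δ'
    reflex      : ∀ Γ Δ → (Γ ++ Δ) ⊢ Γ
    monotone    : ∀ {Γ Δ} Π → Γ ⊢ Δ → (Γ ++ Π) ⊢ (Δ ++ Π)
    trans       : ∀ {Γ Δ Π} → Γ ⊢ Δ → Δ ⊢ Π → Γ ⊢ Π

SubstInvariant : ∀ {L} → (List (Fm L) → List (Fm L) → Set) → Set
SubstInvariant {L} _⊢_ = ∀ (σ : Fm L → Fm L) → IsHom (FmAlg L) σ →
  ∀ {Γ Δ} → Γ ⊢ Δ → map σ Γ ⊢ map σ Δ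

record IsFilter {L a ℓ} (_⊢_ : List (Fm L) → List (Fm L) → Set) (A : Algebra L a)
                (F : Pred (List (Carrier A)) ℓ) : Set (a ⊔ ℓ) where
  field
    downset : IsDownset _≤ₘ_ F
    closed  : ∀ {Γ Δ} → Γ ⊢ Δ → ∀ (𝔠 : List (Carrier A)) (f : Fm L → Carrier A) →
              IsHom A f → F (𝔠 ++ map f Γ) → F (𝔠 ++ map f Δ)

Fi : ∀ {L a} (_⊢_ : List (Fm L) → List (Fm L) → Set) (A : Algebra L a) →
     Pred (Pred (List (Carrier A)) a) a
Fi _⊢_ A F = IsFilter _⊢_ A F

-- Write δ x for the least ⊢-filter containing the multiset x.  Every
-- filter F is the union of the δ x with x ∈ F, and a union of
-- principal filters is again a filter; δ of the family of principal
-- filters is δ itself, so that family is closed under δ.  Right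
-- translation u ↦ u ⊎ z maps filters to filters, since z can be
-- absorbed into the context 𝔠 of the closure condition; this gives the
-- compatibility condition of a deductive system.  Over the formula
-- algebra, Γ ⊢ _ is a filter (by substitution invariance) containing Γ,
-- and every filter containing Γ contains it (take f = id and 𝔠 = ∅),
-- so δ Γ is the set of ⊢-consequences of Γ.
module Submission where

open import Defs
open import Level using (Level; _⊔_) renaming (suc to lsuc)
open import Data.List using (List; _++_; []; map)
open import Data.List.Properties using (map-id)
open import Data.List.Relation.Binary.Permutation.Propositional
  using (_↭_; ↭-refl; ↭-sym; ↭-trans; module PermutationReasoning)
open import Data.List.Relation.Binary.Permutation.Propositional.Properties
  using (++⁺ˡ; ++⁺ʳ; ++-comm; ++-assoc; ++-identityʳ)
open import Data.Product using (Σ; ∃; _×_; _,_; proj₁; proj₂)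
open import Relation.Binary.PropositionalEquality using (refl; subst; sym)
open import Relation.Unary using (Pred; _⊆_; _≐_)
open import Function using (id; _∘_)

module _ {x ℓ k} {X : Set x} (𝒞 : Pred (Pred X ℓ) k) where

  δ-refl : ∀ u → δ 𝒞 u u
  δ-refl u C _ Cu = Cu

  δ-trans : ∀ {u v w} → δ 𝒞 u v → δ 𝒞 v w → δ 𝒞 u w
  δ-trans p q C C∈𝒞 Cu = q C C∈𝒞 (p C C∈𝒞 Cu)

  δ-ᵖ : ∀ u → δ (𝒞 ᵖ) u ≐ δ 𝒞 u
  δ-ᵖ u = (λ d → d (δ 𝒞 u) (u , id , id) (δ-refl u))
        , (λ d C (_ , C⊆ , ⊆C) Cu → ⊆C (δ-trans (C⊆ Cu) d))

  δ-compat : (_∙_ : X → X → X) → (∀ C → 𝒞 C → ∀ z → 𝒞 (λ u → C (u ∙ z))) →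
             ∀ u v z → δ 𝒞 u ⊆ δ 𝒞 v → δ 𝒞 (u ∙ z) ⊆ δ 𝒞 (v ∙ z)
  δ-compat _∙_ translate u v z u⊆v d C C∈𝒞 Cvz =
    d C C∈𝒞 (u⊆v (δ-refl u) (λ w → C (w ∙ z)) (translate C C∈𝒞 z) Cvz)

  δᵖ-compat : (_∙_ : X → X → X) → (∀ C → 𝒞 C → ∀ z → 𝒞 (λ u → C (u ∙ z))) →
              ∀ u v z → δ (𝒞 ᵖ) u ⊆ δ (𝒞 ᵖ) v → δ (𝒞 ᵖ) (u ∙ z) ⊆ δ (𝒞 ᵖ) (v ∙ z)
  δᵖ-compat _∙_ translate u v z u⊆v =
    proj₂ (δ-ᵖ (v ∙ z)) ∘ δ-compat _∙_ translate u v z (proj₁ (δ-ᵖ v) ∘ u⊆v ∘ proj₂ (δ-ᵖ u))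
                         ∘ proj₁ (δ-ᵖ (u ∙ z))

  principalsIn : Pred X ℓ → Pred (Pred X (x ⊔ lsuc ℓ ⊔ k)) (x ⊔ lsuc ℓ ⊔ k)
  principalsIn C S = ∃ λ u → C u × S ≐ δ 𝒞 u

  principalsIn⊆ᵖ : ∀ C → principalsIn C ⊆ 𝒞 ᵖ
  principalsIn⊆ᵖ C (u , _ , S≐δu) = u , S≐δu

  ≐⋃principalsIn : ∀ C → 𝒞 C → C ≐ ⋃ (principalsIn C)
  ≐⋃principalsIn C C∈𝒞 =
      (λ {u} Cu → δ 𝒞 u , (u , Cu , id , id) , δ-refl u)
    , (λ (S , (u , Cu , S⊆δu , _) , Sv) → S⊆δu Sv C C∈𝒞 Cu)

Img-cong : ∀ {r ℓ₁ ℓ₂} {R X : Set r} {g : R → Pred X ℓ₁} {h : R → Pred X ℓ₂} →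
           (∀ u → g u ≐ h u) → Img g ≋ Img h
Img-cong g≐h =
    (λ C (u , C⊆ , ⊆C) → _ , (u , id , id) ,
        (λ c → proj₁ (g≐h u) (C⊆ c)) , (λ d → ⊆C (proj₂ (g≐h u) d)))
  , (λ D (u , D⊆ , ⊆D) → _ , (u , id , id) ,
        (λ c → ⊆D (proj₁ (g≐h u) c)) , (λ d → proj₂ (g≐h u) (D⊆ d)))

module _ {L : Language} (_⊢_ : List (Fm L) → List (Fm L) → Set) {a : Level} (A : Algebra L a) where

  private
    X = List (Carrier A)

  IsFilter-resp-≐ : ∀ {ℓ₁ ℓ₂} {F : Pred X ℓ₁} {G : Pred X ℓ₂} →
                    F ≐ G → IsFilter _⊢_ A F → IsFilter _⊢_ A G
  IsFilter-resp-≐ (F⊆G , G⊆F) F-filter = record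
    { downset = λ u≤v Gv → F⊆G (IsFilter.downset F-filter u≤v (G⊆F Gv))
    ; closed  = λ Γ⊢Δ 𝔠 f f-hom G𝔠Γ →
        F⊆G (IsFilter.closed F-filter Γ⊢Δ 𝔠 f f-hom (G⊆F G𝔠Γ)) }

  IsFilter-resp-↭ : ∀ {ℓ} {F : Pred X ℓ} → IsFilter _⊢_ A F → ∀ {u v} → u ↭ v → F u → F v
  IsFilter-resp-↭ F-filter u↭v =
    IsFilter.downset F-filter ([] , ↭-trans (++-identityʳ _) (↭-sym u↭v))

  ≤ₘ-++ʳ : ∀ {u v : X} z → u ≤ₘ v → (u ++ z) ≤ₘ (v ++ z)
  ≤ₘ-++ʳ {u} {v} z (Π , u⊎Π↭v) = Π , (begin
      (u ++ z) ++ Π  ↭⟨ ++-assoc u z Π ⟩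
      u ++ (z ++ Π)  ↭⟨ ++⁺ˡ u (++-comm z Π) ⟩
      u ++ (Π ++ z)  ↭⟨ ↭-sym (++-assoc u Π z) ⟩
      (u ++ Π) ++ z  ↭⟨ ++⁺ʳ z u⊎Π↭v ⟩
      v ++ z         ∎)
    where open PermutationReasoning

  IsFilter-translate : ∀ {ℓ} {F : Pred X ℓ} → IsFilter _⊢_ A F →
                       ∀ z → IsFilter _⊢_ A (λ u → F (u ++ z))
  IsFilter-translate F-filter z = record
    { downset = λ u≤v → IsFilter.downset F-filter (≤ₘ-++ʳ z u≤v)
    ; closed  = λ {Γ} {Δ} Γ⊢Δ 𝔠 f f-hom F𝔠Γz →
        IsFilter-resp-↭ F-filter (↭-sym (shiftIntoContext 𝔠 (map f Δ)))
          (IsFilter.closed F-filter Γ⊢Δ (z ++ 𝔠) f f-hom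
            (IsFilter-resp-↭ F-filter (shiftIntoContext 𝔠 (map f Γ)) F𝔠Γz)) }
    where
      shiftIntoContext : ∀ (𝔠 w : X) → (𝔠 ++ w) ++ z ↭ (z ++ 𝔠) ++ w
      shiftIntoContext 𝔠 w = ↭-trans (++-comm (𝔠 ++ w) z) (↭-sym (++-assoc z 𝔠 w))

  δ-IsFilter : ∀ {ℓ k} {𝒞 : Pred (Pred X ℓ) k} → (∀ F → 𝒞 F → IsFilter _⊢_ A F) →
               ∀ u → IsFilter _⊢_ A (δ 𝒞 u)
  δ-IsFilter filters u = record
    { downset = λ v≤w d F F∈𝒞 Fu → IsFilter.downset (filters F F∈𝒞) v≤w (d F F∈𝒞 Fu)
    ; closed  = λ Γ⊢Δ 𝔠 f f-hom d F F∈𝒞 Fu →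
        IsFilter.closed (filters F F∈𝒞) Γ⊢Δ 𝔠 f f-hom (d F F∈𝒞 Fu) }

  ⋃-IsFilter : ∀ {ℓ k} {𝒴 : Pred (Pred X ℓ) k} → (∀ S → 𝒴 S → IsFilter _⊢_ A S) →
               IsFilter _⊢_ A (⋃ 𝒴)
  ⋃-IsFilter filters = record
    { downset = λ u≤v (S , S∈𝒴 , Sv) → S , S∈𝒴 , IsFilter.downset (filters S S∈𝒴) u≤v Sv
    ; closed  = λ Γ⊢Δ 𝔠 f f-hom (S , S∈𝒴 , S𝔠Γ) →
        S , S∈𝒴 , IsFilter.closed (filters S S∈𝒴) Γ⊢Δ 𝔠 f f-hom S𝔠Γ }

  Fiᵖ⊆Fi : ∀ C → (Fi _⊢_ A ᵖ) C → IsFilter _⊢_ A C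
  Fiᵖ⊆Fi C (u , C⊆δu , δu⊆C) =
    IsFilter-resp-≐ (δu⊆C , C⊆δu) (δ-IsFilter (λ _ F-filter → F-filter) u)

  Fiᵖ-isDeductiveSystem : IsDeductiveSystem _≤ₘ_ _++_ [] (Fi _⊢_ A ᵖ)
  Fiᵖ-isDeductiveSystem = record
    { downsets  = λ C C∈Fiᵖ → IsFilter.downset (Fiᵖ⊆Fi C C∈Fiᵖ)
    ; principal = Img-cong (δ-ᵖ (Fi _⊢_ A))
    ; compat    = δᵖ-compat (Fi _⊢_ A) _++_ (λ _ → IsFilter-translate) }

module _ {L : Language} {_⊢_ : List (Fm L) → List (Fm L) → Set}
         (mdr : IsMDR _⊢_) (subst-inv : SubstInvariant _⊢_) where

  open IsMDR mdr renaming (trans to ⊢-trans)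

  ⊢-refl : ∀ Γ → Γ ⊢ Γ
  ⊢-refl Γ = wellDefined (++-identityʳ Γ) ↭-refl (reflex Γ [])

  consequences-IsFilter : ∀ Γ → IsFilter _⊢_ (FmAlg L) (Γ ⊢_)
  consequences-IsFilter Γ = record
    { downset = λ {Δ} (Π , Δ⊎Π↭Δ') Γ⊢Δ' → ⊢-trans Γ⊢Δ' (wellDefined Δ⊎Π↭Δ' ↭-refl (reflex Δ Π))
    ; closed  = λ {Γ'} {Δ'} Γ'⊢Δ' 𝔠 σ σ-hom Γ⊢𝔠Γ' →
        ⊢-trans Γ⊢𝔠Γ' (wellDefined (++-comm (map σ Γ') 𝔠) (++-comm (map σ Δ') 𝔠)
                         (monotone 𝔠 (subst-inv σ σ-hom Γ'⊢Δ'))) }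

  δ-Fi-FmAlg : ∀ Γ → δ (Fi _⊢_ (FmAlg L)) Γ ≐ (Γ ⊢_)
  δ-Fi-FmAlg Γ = (λ d → d (Γ ⊢_) (consequences-IsFilter Γ) (⊢-refl Γ))
               , (λ {Δ} Γ⊢Δ F F-filter FΓ → subst F (map-id Δ)
                    (IsFilter.closed F-filter Γ⊢Δ [] id (λ _ _ → refl) (subst F (sym (map-id Γ)) FΓ)))

proposition5p11 : ∀ {L : Language} {a : Level} (_⊢_ : List (Fm L) → List (Fm L) → Set) →
    IsMDR _⊢_ → SubstInvariant _⊢_ →
    ((∀ (A : Algebra L a) →
        IsDeductiveSystem _≤ₘ_ _++_ [] (Fi _⊢_ A ᵖ)
        × ((∀ F → Fi _⊢_ A F →
              Σ (Pred (Pred (List (Carrier A)) (lsuc a)) (lsuc a))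
                λ 𝒴 → (𝒴 ⊆ Fi _⊢_ A ᵖ) × (F ≐ ⋃ 𝒴))
           × (∀ (𝒴 : Pred (Pred (List (Carrier A)) (lsuc a)) (lsuc a)) →
              𝒴 ⊆ Fi _⊢_ A ᵖ → IsFilter _⊢_ A (⋃ 𝒴))))
     × ((Fi _⊢_ (FmAlg L) ᵖ) ≋ Img (λ Γ Δ → Γ ⊢ Δ)))
proposition5p11 _⊢_ mdr subst-inv =
    (λ A → Fiᵖ-isDeductiveSystem _⊢_ A
         , (λ F F-filter → principalsIn (Fi _⊢_ A) F
                         , principalsIn⊆ᵖ (Fi _⊢_ A) F
                         , ≐⋃principalsIn (Fi _⊢_ A) F F-filter)
         , (λ 𝒴 𝒴⊆Fiᵖ → ⋃-IsFilter _⊢_ A (λ S S∈𝒴 → Fiᵖ⊆Fi _⊢_ A S (𝒴⊆Fiᵖ S∈𝒴))))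
  , Img-cong (δ-Fi-FmAlg mdr subst-inv)
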